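{- There exists a constant $\lambda$ such that for every integer $c\ge \lambda$ there exist a graph $G=(R,E)$ and a set $Y \subseteq R$ such that ${\sf td}(G)=c$, $|Y| \ge 2^{c-3}$, ${\sf conf}_{R}(Y)>0$, and ${\sf conf}_{R}(\bar{Y})=0$ for every $\bar{Y} \subsetneq Y$.
   Context: Treedepth ${\sf td}$ of a graph: minimum height (number of vertices on a longest root-to-leaf path) of a rooted forest whose closure (each vertex joined to all its ancestors) contains the graph as a subgraph. For $A\subseteq R$, $\alpha(A)$ denotes the maximum size of an independent set in $G[A]$, and for $Y\subseteq R$, ${\sf conf}_R(Y)=\alpha(R)-\alpha(R\setminus Y)$. -}

module Defs where

open import Data.Bool using (Bool; true; false)
open import Data.Nat using (ℕ; zero; suc; _≤_; _∸_; _⊔_)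
open import Data.Fin using (Fin)
open import Data.Fin.Subset using (Subset; _∈_; _⊆_; ∣_∣; inside; outside; ⊤)
open import Data.Fin.Subset.Properties using (_∈?_; _⊆?_)
open import Data.Fin.Properties using (all?)
open import Data.List using (List; []; _∷_; map; _++_; foldr)
open import Data.Maybe using (Maybe; just; nothing)
open import Data.Product using (Σ; _×_; ∃)
open import Data.Sum using (_⊎_)
open import Relation.Binary.PropositionalEquality using (_≡_)
open import Relation.Nullary using (Dec; yes; no; ¬_)
open import Relation.Nullary.Decidable using (_→-dec_; _×-dec_)
open import Data.Bool.Properties using () renaming (_≟_ to _≟B_)

record Graph : Set where
  field
    n     : ℕ
    adj   : Fin n → Fin n → Bool
    sym   : ∀ u v → adj u v ≡ adj v u
    irrfl : ∀ u → adj u u ≡ false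

open Graph public

Edge : (G : Graph) → Fin (n G) → Fin (n G) → Set
Edge G u v = adj G u v ≡ true

Independent : (G : Graph) → Subset (n G) → Set
Independent G S = ∀ u v → u ∈ S → v ∈ S → adj G u v ≡ false

independent? : (G : Graph) (S : Subset (n G)) → Dec (Independent G S)
independent? G S =
  all? (λ u → all? (λ v → (u ∈? S) →-dec ((v ∈? S) →-dec (adj G u v ≟B false))))

allSubsets : (m : ℕ) → List (Subset m)
allSubsets zero    = Data.Vec.[] ∷ []
  where import Data.Vec
allSubsets (suc m) = map (inside Data.Vec.∷_) (allSubsets m)
                  ++ map (outside Data.Vec.∷_) (allSubsets m)
  where import Data.Vec

candidate : (G : Graph) → Subset (n G) → Subset (n G) → ℕ
candidate G A S with S ⊆? A | independent? G S
... | yes _ | yes _ = ∣ S ∣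
... | _     | _     = 0

α : (G : Graph) → Subset (n G) → ℕ
α G A = foldr _⊔_ 0 (map (candidate G A) (allSubsets (n G)))

-- conf_R(Y) = α(R) - α(R \ Y), with R the full vertex set
-- (this difference is always ≥ 0 since α is monotone)
conf : (G : Graph) → Subset (n G) → ℕ
conf G Y = α G ⊤ ∸ α G (⊤ Data.Fin.Subset.─ Y)

-- A rooted forest is given by a parent map together with a depth function
-- certifying acyclicity: roots have depth 1 and a child has depth one more
-- than its parent.  The height of the forest is the maximum depth
-- (number of vertices on a longest root-to-leaf path).

record RootedForest (m : ℕ) : Set where
  field
    parent     : Fin m → Maybe (Fin m)
    depth      : Fin m → ℕ
    depth-root : ∀ v → parent v ≡ nothing → depth v ≡ 1
    depth-step : ∀ v u → parent v ≡ just u → depth v ≡ suc (depth u)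

open RootedForest public

data Ancestor {m : ℕ} (F : RootedForest m) : Fin m → Fin m → Set where
  here  : ∀ {v} → Ancestor F v v
  there : ∀ {u w v} → parent F v ≡ just w → Ancestor F u w → Ancestor F u v

HeightAtMost : ∀ {m} → RootedForest m → ℕ → Set
HeightAtMost F h = ∀ v → depth F v ≤ h

ClosureContains : (G : Graph) → RootedForest (n G) → Set
ClosureContains G F = ∀ u v → Edge G u v → Ancestor F u v ⊎ Ancestor F v u

TdAtMost : Graph → ℕ → Set
TdAtMost G h = Σ (RootedForest (n G)) λ F → HeightAtMost F h × ClosureContains G F

TdEq : Graph → ℕ → Set
TdEq G c = TdAtMost G c × (∀ h → TdAtMost G h → c ≤ h)

-- With c = m + 3, the graph is an apex r joined to a set N of a gadget V_m (Gadget m), next to a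
-- disjoint clique K_c, and Y is the set Y_m inside V_m, of size 2^m.  The gadget doubles at each
-- step: V_{m+1} is two copies of V_m plus an apex seeing N in the first copy and M ⊇ N in the
-- second.  Induction shows α(V_m) = 2^m, that stable sets avoiding M, or avoiding both N and Y,
-- have size < 2^m, and that each a ∈ Y lies in a stable set of size 2^m avoiding N and meeting Y
-- only in a.  So α(G) = 2^m + 2 (r, such a set, one clique vertex) survives the removal of any
-- proper subset of Y, while without Y it drops to 2^m + 1.  The clique forces td(G) ≥ c, and V_m
-- has a forest of height m + 2 that fits below r.

module Submission where

open import Defs hiding (sym)
open import Data.Bool using (Bool; true; false; not)
open import Data.Empty using (⊥-elim)
open import Data.Fin using (Fin; zero; suc; _↑ˡ_; _↑ʳ_; splitAt; toℕ; fromℕ<)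
open import Data.Fin.Properties
  using (splitAt-↑ˡ; splitAt-↑ʳ; splitAt⁻¹-↑ˡ; splitAt⁻¹-↑ʳ; pigeonhole; toℕ-fromℕ<)
  renaming (<⇒≢ to <ᶠ⇒≢)
open import Data.Fin.Subset using (Subset; _⊂_; _⊆_; _∉_; ∣_∣; ⊤; ⊥; _─_; ⁅_⁆)
open import Data.Fin.Subset.Properties using (_⊆?_; ⊆⊤; x∈⁅y⁆⇒x≡y; ∣⁅x⁆∣≡1; ∣⊥∣≡0)
open import Data.List using (List; map; foldr)
open import Data.List.Membership.Propositional using () renaming (_∈_ to _∈ᴸ_)
open import Data.List.Membership.Propositional.Properties using (∈-map⁺; ∈-++⁺ˡ; ∈-++⁺ʳ)
open import Data.List.Relation.Unary.Any using (here; there)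
open import Data.Maybe using (Maybe; just; nothing)
open import Data.Nat using (ℕ; zero; suc; _≤_; _<_; _∸_; _^_; _+_; _*_; _⊔_; z≤n; s≤s; pred; _≤?_; >-nonZero)
open import Data.Nat.Properties
open import Data.Product using (Σ; _×_; _,_; proj₁; proj₂)
open import Data.Sum using (_⊎_; inj₁; inj₂; [_,_]′)
import Data.Sum as Sum
open import Data.Vec using ([]; _∷_; lookup; _++_)
import Data.Vec as Vec
open import Data.Vec.Properties using ([]=⇒lookup; lookup⇒[]=; lookup-++ˡ; lookup-++ʳ; lookup-replicate)
open import Relation.Binary.PropositionalEquality
open import Relation.Nullary using (yes; no)

false≢true : false ≢ true
false≢true ()

-- Independence phrased with lookup, which computes on the concatenated subsets used below.
Stable : (G : Graph) → Subset (n G) → Set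
Stable G S = ∀ u v → lookup S u ≡ true → lookup S v ≡ true → adj G u v ≡ false

Disjoint : ∀ {k} → Subset k → Subset k → Set
Disjoint S T = ∀ i → lookup S i ≡ true → lookup T i ≡ false

Independent⇒Stable : ∀ G S → Independent G S → Stable G S
Independent⇒Stable G S ind u v u∈S v∈S = ind u v (lookup⇒[]= u S u∈S) (lookup⇒[]= v S v∈S)

Stable⇒Independent : ∀ G S → Stable G S → Independent G S
Stable⇒Independent G S st u v u∈S v∈S = st u v ([]=⇒lookup u∈S) ([]=⇒lookup v∈S)

singleton-stable : ∀ G v → Stable G ⁅ v ⁆
singleton-stable G v u w u∈S w∈S
  with x∈⁅y⁆⇒x≡y v (lookup⇒[]= u ⁅ v ⁆ u∈S) | x∈⁅y⁆⇒x≡y v (lookup⇒[]= w ⁅ v ⁆ w∈S)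
... | refl | refl = irrfl G v

lookup-⊥ : ∀ {k} (i : Fin k) → lookup ⊥ i ≡ false
lookup-⊥ i = lookup-replicate i false

⊥-stable : ∀ G → Stable G ⊥
⊥-stable G u v u∈⊥ _ with trans (sym u∈⊥) (lookup-⊥ u)
... | ()

Disjoint-⊥ : ∀ {k} (S : Subset k) → Disjoint S ⊥
Disjoint-⊥ S i _ = lookup-⊥ i

⊥-Disjoint : ∀ {k} (T : Subset k) → Disjoint ⊥ T
⊥-Disjoint T i i∈⊥ = ⊥-elim (false≢true (trans (sym (lookup-⊥ i)) i∈⊥))

Disjoint-⊤⇒∣∣≡0 : ∀ {k} (S : Subset k) → Disjoint S ⊤ → ∣ S ∣ ≡ 0
Disjoint-⊤⇒∣∣≡0 []          _    = refl
Disjoint-⊤⇒∣∣≡0 (true  ∷ S) S#⊤ with S#⊤ zero refl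
... | ()
Disjoint-⊤⇒∣∣≡0 (false ∷ S) S#⊤ = Disjoint-⊤⇒∣∣≡0 S (λ i → S#⊤ (suc i))

MeetsOnlyAt : ∀ {k} → Subset k → Subset k → Fin k → Set
MeetsOnlyAt S T a = ∀ j → lookup S j ≡ true → lookup T j ≡ true → j ≡ a

MeetsOnlyAt⇒Disjoint : ∀ {k} (S T T' : Subset k) {a} → MeetsOnlyAt S T a → T' ⊆ T → a ∉ T' → Disjoint S T'
MeetsOnlyAt⇒Disjoint S T T' meets T'⊆T a∉T' j j∈S with lookup T' j in j∈T'
... | false = refl
... | true with meets j j∈S ([]=⇒lookup (T'⊆T (lookup⇒[]= j T' j∈T')))
...   | refl = ⊥-elim (a∉T' (lookup⇒[]= j T' j∈T'))

Disjoint-antitone : ∀ {k} {S T U : Subset k} →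
                    (∀ i → lookup T i ≡ true → lookup U i ≡ true) → Disjoint S U → Disjoint S T
Disjoint-antitone {T = T} T⊆U S#U i i∈S with lookup T i in eq
... | false = refl
... | true with trans (sym (S#U i i∈S)) (T⊆U i eq)
...   | ()

lookup-─ : ∀ {k} (Y : Subset k) i → lookup (⊤ ─ Y) i ≡ not (lookup Y i)
lookup-─ (true  ∷ Y) zero    = refl
lookup-─ (false ∷ Y) zero    = refl
lookup-─ (_     ∷ Y) (suc i) = lookup-─ Y i

⊆─⇒Disjoint : ∀ {k} (S Y : Subset k) → S ⊆ ⊤ ─ Y → Disjoint S Y
⊆─⇒Disjoint S Y S⊆ i i∈S
  with lookup Y i | trans (sym (lookup-─ Y i)) ([]=⇒lookup (S⊆ (lookup⇒[]= i S i∈S)))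
... | false | _  = refl
... | true  | ()

Disjoint⇒⊆─ : ∀ {k} (S Y : Subset k) → Disjoint S Y → S ⊆ ⊤ ─ Y
Disjoint⇒⊆─ S Y S#Y {i} i∈S =
  lookup⇒[]= i (⊤ ─ Y) (trans (lookup-─ Y i) (cong not (S#Y i ([]=⇒lookup i∈S))))

∣++∣ : ∀ {k l} (S : Subset k) (T : Subset l) → ∣ S ++ T ∣ ≡ ∣ S ∣ + ∣ T ∣
∣++∣ []          T = refl
∣++∣ (true  ∷ S) T = cong suc (∣++∣ S T)
∣++∣ (false ∷ S) T = ∣++∣ S T

allSubsets-complete : ∀ m (S : Subset m) → S ∈ᴸ allSubsets m
allSubsets-complete zero    []          = here refl
allSubsets-complete (suc m) (true  ∷ S) = ∈-++⁺ˡ (∈-map⁺ (true ∷_) (allSubsets-complete m S))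
allSubsets-complete (suc m) (false ∷ S) =
  ∈-++⁺ʳ (map (true ∷_) (allSubsets m)) (∈-map⁺ (false ∷_) (allSubsets-complete m S))

foldr-⊔-lub : ∀ {X : Set} (f : X → ℕ) k (xs : List X) → (∀ x → f x ≤ k) → foldr _⊔_ 0 (map f xs) ≤ k
foldr-⊔-lub f k List.[]       f≤k = z≤n
foldr-⊔-lub f k (x List.∷ xs) f≤k = ⊔-lub (f≤k x) (foldr-⊔-lub f k xs f≤k)

foldr-⊔-upper : ∀ {X : Set} (f : X → ℕ) (xs : List X) {x} → x ∈ᴸ xs → f x ≤ foldr _⊔_ 0 (map f xs)
foldr-⊔-upper f (x List.∷ xs) (here refl) = m≤m⊔n (f x) _
foldr-⊔-upper f (y List.∷ xs) (there x∈xs) = ≤-trans (foldr-⊔-upper f xs x∈xs) (m≤n⊔m (f y) _)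

candidate-≤ : ∀ G A k → (∀ S → S ⊆ A → Stable G S → ∣ S ∣ ≤ k) → ∀ S → candidate G A S ≤ k
candidate-≤ G A k bound S with S ⊆? A | independent? G S
... | yes S⊆A | yes ind = bound S S⊆A (Independent⇒Stable G S ind)
... | yes _   | no  _   = z≤n
... | no  _   | _       = z≤n

∣S∣≤candidate : ∀ G A S → S ⊆ A → Stable G S → ∣ S ∣ ≤ candidate G A S
∣S∣≤candidate G A S S⊆A st with S ⊆? A | independent? G S
... | yes _ | yes _   = ≤-refl
... | yes _ | no ¬ind = ⊥-elim (¬ind (Stable⇒Independent G S st))
... | no ¬S⊆A | _     = ⊥-elim (¬S⊆A S⊆A)

α-lub : ∀ G A k → (∀ S → S ⊆ A → Stable G S → ∣ S ∣ ≤ k) → α G A ≤ k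
α-lub G A k bound = foldr-⊔-lub (candidate G A) k (allSubsets (n G)) (candidate-≤ G A k bound)

stable≤α : ∀ G A S → S ⊆ A → Stable G S → ∣ S ∣ ≤ α G A
stable≤α G A S S⊆A st = ≤-trans (∣S∣≤candidate G A S S⊆A st)
  (foldr-⊔-upper (candidate G A) (allSubsets (n G)) (allSubsets-complete (n G) S))

conf-positive : ∀ G Y S k → Stable G S → suc k ≤ ∣ S ∣ →
                (∀ T → Stable G T → Disjoint T Y → ∣ T ∣ ≤ k) → 0 < conf G Y
conf-positive G Y S k st k<∣S∣ bound = begin
  1                           ≡⟨ m+n∸n≡m 1 k ⟨
  suc k ∸ k                   ≤⟨ ∸-mono k<α α─Y≤k ⟩
  α G ⊤ ∸ α G (⊤ ─ Y)         ∎
  where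
  open ≤-Reasoning
  k<α : suc k ≤ α G ⊤
  k<α = ≤-trans k<∣S∣ (stable≤α G ⊤ S ⊆⊤ st)
  α─Y≤k : α G (⊤ ─ Y) ≤ k
  α─Y≤k = α-lub G (⊤ ─ Y) k (λ T T⊆ st → bound T st (⊆─⇒Disjoint T Y T⊆))

conf-zero : ∀ G Y S k → (∀ T → Stable G T → ∣ T ∣ ≤ k) →
            Stable G S → Disjoint S Y → k ≤ ∣ S ∣ → conf G Y ≡ 0
conf-zero G Y S k bound st S#Y k≤∣S∣ = m≤n⇒m∸n≡0 (begin
  α G ⊤          ≤⟨ α-lub G ⊤ k (λ T _ → bound T) ⟩
  k              ≤⟨ k≤∣S∣ ⟩
  ∣ S ∣          ≤⟨ stable≤α G (⊤ ─ Y) S (Disjoint⇒⊆─ S Y S#Y) st ⟩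
  α G (⊤ ─ Y)    ∎)
  where open ≤-Reasoning

-- Apex joins

glue : ∀ {n₁ n₂} → Bool → Subset n₁ → Subset n₂ → Subset (suc (n₁ + n₂))
glue x S₁ S₂ = x ∷ (S₁ ++ S₂)

module ApexVertices (n₁ n₂ : ℕ) where

  embedˡ : Fin n₁ → Fin (suc (n₁ + n₂))
  embedˡ a = suc (a ↑ˡ n₂)

  embedʳ : Fin n₂ → Fin (suc (n₁ + n₂))
  embedʳ b = suc (n₁ ↑ʳ b)

  data Position : Fin (suc (n₁ + n₂)) → Set where
    top : Position zero
    inˡ : (a : Fin n₁) → Position (embedˡ a)
    inʳ : (b : Fin n₂) → Position (embedʳ b)

  position : ∀ v → Position v
  position zero = top
  position (suc v) with splitAt n₁ v in eq
  ... | inj₁ a = subst (λ w → Position (suc w)) (splitAt⁻¹-↑ˡ eq) (inˡ a)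
  ... | inj₂ b = subst (λ w → Position (suc w)) (splitAt⁻¹-↑ʳ eq) (inʳ b)

  data Glued : Subset (suc (n₁ + n₂)) → Set where
    glued : ∀ x (S₁ : Subset n₁) (S₂ : Subset n₂) → Glued (glue x S₁ S₂)

  unglue : ∀ S → Glued S
  unglue (x ∷ T) with Vec.splitAt n₁ T
  ... | S₁ , S₂ , refl = glued x S₁ S₂

  lookup-glueˡ : ∀ x S₁ S₂ a → lookup (glue x S₁ S₂) (embedˡ a) ≡ lookup S₁ a
  lookup-glueˡ x S₁ S₂ a = lookup-++ˡ S₁ S₂ a

  lookup-glueʳ : ∀ x S₁ S₂ b → lookup (glue x S₁ S₂) (embedʳ b) ≡ lookup S₂ b
  lookup-glueʳ x S₁ S₂ b = lookup-++ʳ S₁ S₂ b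

  module GlueMembership (x : Bool) (S₁ : Subset n₁) (S₂ : Subset n₂) where

    ∈ˡ⁺ : ∀ a → lookup S₁ a ≡ true → lookup (glue x S₁ S₂) (embedˡ a) ≡ true
    ∈ˡ⁺ a a∈ = trans (lookup-glueˡ x S₁ S₂ a) a∈

    ∈ʳ⁺ : ∀ b → lookup S₂ b ≡ true → lookup (glue x S₁ S₂) (embedʳ b) ≡ true
    ∈ʳ⁺ b b∈ = trans (lookup-glueʳ x S₁ S₂ b) b∈

    ∈ˡ⁻ : ∀ a → lookup (glue x S₁ S₂) (embedˡ a) ≡ true → lookup S₁ a ≡ true
    ∈ˡ⁻ a a∈ = trans (sym (lookup-glueˡ x S₁ S₂ a)) a∈

    ∈ʳ⁻ : ∀ b → lookup (glue x S₁ S₂) (embedʳ b) ≡ true → lookup S₂ b ≡ true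
    ∈ʳ⁻ b b∈ = trans (sym (lookup-glueʳ x S₁ S₂ b)) b∈

  Disjoint-glue⁻ : ∀ x S₁ S₂ y T₁ T₂ → Disjoint (glue x S₁ S₂) (glue y T₁ T₂) →
                   (x ≡ true → y ≡ false) × Disjoint S₁ T₁ × Disjoint S₂ T₂
  Disjoint-glue⁻ x S₁ S₂ y T₁ T₂ S#T =
      S#T zero
    , (λ a a∈S → trans (sym (lookup-glueˡ y T₁ T₂ a)) (S#T (embedˡ a) (∈ˡ⁺ a a∈S)))
    , (λ b b∈S → trans (sym (lookup-glueʳ y T₁ T₂ b)) (S#T (embedʳ b) (∈ʳ⁺ b b∈S)))
    where open GlueMembership x S₁ S₂

  Disjoint-glue⁺ : ∀ x S₁ S₂ y T₁ T₂ → (x ≡ true → y ≡ false) → Disjoint S₁ T₁ → Disjoint S₂ T₂ →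
                   Disjoint (glue x S₁ S₂) (glue y T₁ T₂)
  Disjoint-glue⁺ x S₁ S₂ y T₁ T₂ x#y S₁#T₁ S₂#T₂ = disjoint
    where
    open GlueMembership x S₁ S₂
    disjoint : Disjoint (glue x S₁ S₂) (glue y T₁ T₂)
    disjoint v v∈S with position v
    ... | top   = x#y v∈S
    ... | inˡ a = trans (lookup-glueˡ y T₁ T₂ a) (S₁#T₁ a (∈ˡ⁻ a v∈S))
    ... | inʳ b = trans (lookup-glueʳ y T₁ T₂ b) (S₂#T₂ b (∈ʳ⁻ b v∈S))

sumAdj : (G₁ G₂ : Graph) → Fin (n G₁) ⊎ Fin (n G₂) → Fin (n G₁) ⊎ Fin (n G₂) → Bool
sumAdj G₁ G₂ (inj₁ a) (inj₁ a') = adj G₁ a a'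
sumAdj G₁ G₂ (inj₂ b) (inj₂ b') = adj G₂ b b'
sumAdj G₁ G₂ (inj₁ _) (inj₂ _)  = false
sumAdj G₁ G₂ (inj₂ _) (inj₁ _)  = false

sumAdj-sym : ∀ G₁ G₂ x y → sumAdj G₁ G₂ x y ≡ sumAdj G₁ G₂ y x
sumAdj-sym G₁ G₂ (inj₁ a) (inj₁ a') = Graph.sym G₁ a a'
sumAdj-sym G₁ G₂ (inj₂ b) (inj₂ b') = Graph.sym G₂ b b'
sumAdj-sym G₁ G₂ (inj₁ _) (inj₂ _)  = refl
sumAdj-sym G₁ G₂ (inj₂ _) (inj₁ _)  = refl

sumAdj-irrefl : ∀ G₁ G₂ x → sumAdj G₁ G₂ x x ≡ false
sumAdj-irrefl G₁ G₂ (inj₁ a) = irrfl G₁ a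
sumAdj-irrefl G₁ G₂ (inj₂ b) = irrfl G₂ b

apexAdj : (G₁ G₂ : Graph) → Subset (n G₁) → Subset (n G₂) →
          Fin (suc (n G₁ + n G₂)) → Fin (suc (n G₁ + n G₂)) → Bool
apexAdj G₁ G₂ N₁ N₂ zero    zero    = false
apexAdj G₁ G₂ N₁ N₂ zero    (suc v) = lookup (N₁ ++ N₂) v
apexAdj G₁ G₂ N₁ N₂ (suc u) zero    = lookup (N₁ ++ N₂) u
apexAdj G₁ G₂ N₁ N₂ (suc u) (suc v) = sumAdj G₁ G₂ (splitAt (n G₁) u) (splitAt (n G₁) v)

apexAdj-sym : ∀ G₁ G₂ N₁ N₂ u v → apexAdj G₁ G₂ N₁ N₂ u v ≡ apexAdj G₁ G₂ N₁ N₂ v u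
apexAdj-sym G₁ G₂ N₁ N₂ zero    zero    = refl
apexAdj-sym G₁ G₂ N₁ N₂ zero    (suc v) = refl
apexAdj-sym G₁ G₂ N₁ N₂ (suc u) zero    = refl
apexAdj-sym G₁ G₂ N₁ N₂ (suc u) (suc v) = sumAdj-sym G₁ G₂ (splitAt (n G₁) u) (splitAt (n G₁) v)

apexAdj-irrefl : ∀ G₁ G₂ N₁ N₂ u → apexAdj G₁ G₂ N₁ N₂ u u ≡ false
apexAdj-irrefl G₁ G₂ N₁ N₂ zero    = refl
apexAdj-irrefl G₁ G₂ N₁ N₂ (suc u) = sumAdj-irrefl G₁ G₂ (splitAt (n G₁) u)

apexJoin : (G₁ G₂ : Graph) → Subset (n G₁) → Subset (n G₂) → Graph
apexJoin G₁ G₂ N₁ N₂ = record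
  { n     = suc (n G₁ + n G₂)
  ; adj   = apexAdj G₁ G₂ N₁ N₂
  ; sym   = apexAdj-sym G₁ G₂ N₁ N₂
  ; irrfl = apexAdj-irrefl G₁ G₂ N₁ N₂
  }

module ApexJoin (G₁ G₂ : Graph) (N₁ : Subset (n G₁)) (N₂ : Subset (n G₂)) where

  open ApexVertices (n G₁) (n G₂) public

  private
    G = apexJoin G₁ G₂ N₁ N₂
    n₁ = n G₁
    n₂ = n G₂

  adj-ˡˡ : ∀ a a' → adj G (embedˡ a) (embedˡ a') ≡ adj G₁ a a'
  adj-ˡˡ a a' rewrite splitAt-↑ˡ n₁ a n₂ | splitAt-↑ˡ n₁ a' n₂ = refl

  adj-ʳʳ : ∀ b b' → adj G (embedʳ b) (embedʳ b') ≡ adj G₂ b b'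
  adj-ʳʳ b b' rewrite splitAt-↑ʳ n₁ n₂ b | splitAt-↑ʳ n₁ n₂ b' = refl

  adj-ˡʳ : ∀ a b → adj G (embedˡ a) (embedʳ b) ≡ false
  adj-ˡʳ a b rewrite splitAt-↑ˡ n₁ a n₂ | splitAt-↑ʳ n₁ n₂ b = refl

  adj-ʳˡ : ∀ b a → adj G (embedʳ b) (embedˡ a) ≡ false
  adj-ʳˡ b a rewrite splitAt-↑ˡ n₁ a n₂ | splitAt-↑ʳ n₁ n₂ b = refl

  adj-topˡ : ∀ a → adj G zero (embedˡ a) ≡ lookup N₁ a
  adj-topˡ a = lookup-++ˡ N₁ N₂ a

  adj-topʳ : ∀ b → adj G zero (embedʳ b) ≡ lookup N₂ b
  adj-topʳ b = lookup-++ʳ N₁ N₂ b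

  Stable-glue⁻ : ∀ x S₁ S₂ → Stable G (glue x S₁ S₂) →
                 Stable G₁ S₁ × Stable G₂ S₂ × (x ≡ true → Disjoint S₁ N₁ × Disjoint S₂ N₂)
  Stable-glue⁻ x S₁ S₂ st =
      (λ a a' a∈ a'∈ → trans (sym (adj-ˡˡ a a')) (st (embedˡ a) (embedˡ a') (∈ˡ⁺ a a∈) (∈ˡ⁺ a' a'∈)))
    , (λ b b' b∈ b'∈ → trans (sym (adj-ʳʳ b b')) (st (embedʳ b) (embedʳ b') (∈ʳ⁺ b b∈) (∈ʳ⁺ b' b'∈)))
    , (λ x∈ → (λ a a∈ → trans (sym (adj-topˡ a)) (st zero (embedˡ a) x∈ (∈ˡ⁺ a a∈)))
            , (λ b b∈ → trans (sym (adj-topʳ b)) (st zero (embedʳ b) x∈ (∈ʳ⁺ b b∈))))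
    where open GlueMembership x S₁ S₂

  Stable-glue⁺ : ∀ x S₁ S₂ → Stable G₁ S₁ → Stable G₂ S₂ →
                 (x ≡ true → Disjoint S₁ N₁ × Disjoint S₂ N₂) → Stable G (glue x S₁ S₂)
  Stable-glue⁺ x S₁ S₂ st₁ st₂ st₀ = stable
    where
    open GlueMembership x S₁ S₂
    stable : Stable G (glue x S₁ S₂)
    stable u v u∈ v∈ with position u | position v
    ... | top   | top    = refl
    ... | top   | inˡ a  = trans (adj-topˡ a) (proj₁ (st₀ u∈) a (∈ˡ⁻ a v∈))
    ... | top   | inʳ b  = trans (adj-topʳ b) (proj₂ (st₀ u∈) b (∈ʳ⁻ b v∈))
    ... | inˡ a | top    = trans (adj-topˡ a) (proj₁ (st₀ v∈) a (∈ˡ⁻ a u∈))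
    ... | inʳ b | top    = trans (adj-topʳ b) (proj₂ (st₀ v∈) b (∈ʳ⁻ b u∈))
    ... | inˡ a | inˡ a' = trans (adj-ˡˡ a a') (st₁ a a' (∈ˡ⁻ a u∈) (∈ˡ⁻ a' v∈))
    ... | inʳ b | inʳ b' = trans (adj-ʳʳ b b') (st₂ b b' (∈ʳ⁻ b u∈) (∈ʳ⁻ b' v∈))
    ... | inˡ a | inʳ b  = adj-ˡʳ a b
    ... | inʳ b | inˡ a  = adj-ʳˡ b a

depth-positive : ∀ {k} (F : RootedForest k) v → 1 ≤ depth F v
depth-positive F v with parent F v in eq
... | nothing rewrite depth-root F v eq = s≤s z≤n
... | just u  rewrite depth-step F v u eq = s≤s z≤n

Ancestor-trans : ∀ {k} {F : RootedForest k} {u w v} → Ancestor F u w → Ancestor F w v → Ancestor F u v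
Ancestor-trans u≼w here            = u≼w
Ancestor-trans u≼w (there eq w≼v) = there eq (Ancestor-trans u≼w w≼v)

root-ancestor : ∀ {k} (F : RootedForest k) v → Σ (Fin k) λ r → parent F r ≡ nothing × Ancestor F r v
root-ancestor F v = go (depth F v) v ≤-refl
  where
  go : ∀ d v → depth F v ≤ d → Σ _ λ r → parent F r ≡ nothing × Ancestor F r v
  go zero v dv≤0 with ≤-trans (depth-positive F v) dv≤0
  ... | ()
  go (suc d) v dv≤d with parent F v in eq
  ... | nothing = v , eq , here
  ... | just w with go d w (≤-pred (subst (_≤ suc d) (depth-step F v w eq) dv≤d))
  ...   | r , root , r≼w = r , root , there eq r≼w

Ancestor⇒≡⊎depth< : ∀ {k} (F : RootedForest k) {u v} → Ancestor F u v → u ≡ v ⊎ depth F u < depth F v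
Ancestor⇒≡⊎depth< F here = inj₁ refl
Ancestor⇒≡⊎depth< F {u} {v} (there {w = w} eq u≼w) with Ancestor⇒≡⊎depth< F u≼w
... | inj₁ refl = inj₂ (≤-reflexive (sym (depth-step F v u eq)))
... | inj₂ du<dw = inj₂ (≤-trans du<dw (≤-trans (n≤1+n _) (≤-reflexive (sym (depth-step F v w eq)))))

comparable-same-depth⇒≡ : ∀ {k} (F : RootedForest k) {u v} → Ancestor F u v ⊎ Ancestor F v u →
                           depth F u ≡ depth F v → u ≡ v
comparable-same-depth⇒≡ F (inj₁ u≼v) du≡dv with Ancestor⇒≡⊎depth< F u≼v
... | inj₁ u≡v  = u≡v
... | inj₂ du<dv = ⊥-elim (<-irrefl du≡dv du<dv)
comparable-same-depth⇒≡ F (inj₂ v≼u) du≡dv with Ancestor⇒≡⊎depth< F v≼u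
... | inj₁ v≡u  = sym v≡u
... | inj₂ dv<du = ⊥-elim (<-irrefl (sym du≡dv) dv<du)

-- A clique lies on one root path of the forest, so its vertices have pairwise distinct depths.
clique⇒td≥ : ∀ G {k h} (κ : Fin k → Fin (n G)) → (∀ i j → i ≢ j → Edge G (κ i) (κ j)) →
             TdAtMost G h → k ≤ h
clique⇒td≥ G {k} {h} κ edge (F , height , closure) = k≤h
  where
  pred< : ∀ {d} → 1 ≤ d → d ≤ h → pred d < h
  pred< {suc d} _ d≤h = d≤h
  level : Fin k → Fin h
  level i = fromℕ< (pred< (depth-positive F (κ i)) (height (κ i)))
  distinct-levels : ∀ i j → i ≢ j → level i ≢ level j
  distinct-levels i j i≢j same-level = false≢true (begin
    false               ≡⟨ irrfl G (κ j) ⟨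
    adj G (κ j) (κ j)   ≡⟨ cong (λ v → adj G v (κ j)) κi≡κj ⟨
    adj G (κ i) (κ j)   ≡⟨ edge i j i≢j ⟩
    true                ∎)
    where
    open ≡-Reasoning
    same-depth : depth F (κ i) ≡ depth F (κ j)
    same-depth = pred-injective {{>-nonZero (depth-positive F (κ i))}} {{>-nonZero (depth-positive F (κ j))}}
      (trans (sym (toℕ-fromℕ< _)) (trans (cong toℕ same-level) (toℕ-fromℕ< _)))
    κi≡κj : κ i ≡ κ j
    κi≡κj = comparable-same-depth⇒≡ F (closure (κ i) (κ j) (edge i j i≢j)) same-depth
  k≤h : k ≤ h
  k≤h with k ≤? h
  ... | yes k≤h = k≤h
  ... | no k≰h with pigeonhole (≰⇒> k≰h) level
  ...   | i , j , i<j , same-level = ⊥-elim (distinct-levels i j (<ᶠ⇒≢ i<j) same-level)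

raiseIf : Bool → ℕ → ℕ
raiseIf true  d = suc d
raiseIf false d = d

raiseIf-mono : ∀ t {d e} → d ≤ e → raiseIf t d ≤ raiseIf t e
raiseIf-mono true  d≤e = s≤s d≤e
raiseIf-mono false d≤e = d≤e

-- The roots of F₁ are hung below the apex, those of F₂ only when attach is true.
module ApexForest {n₁ n₂} (F₁ : RootedForest n₁) (F₂ : RootedForest n₂) where

  open ApexVertices n₁ n₂

  parentˡ : Maybe (Fin n₁) → Maybe (Fin (suc (n₁ + n₂)))
  parentˡ (just a) = just (embedˡ a)
  parentˡ nothing  = just zero

  parentˡ≢nothing : ∀ p → parentˡ p ≢ nothing
  parentˡ≢nothing (just _) ()
  parentˡ≢nothing nothing  ()

  parentʳ : Bool → Maybe (Fin n₂) → Maybe (Fin (suc (n₁ + n₂)))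
  parentʳ _     (just b) = just (embedʳ b)
  parentʳ true  nothing  = just zero
  parentʳ false nothing  = nothing

  parentᶠ : Bool → Fin (suc (n₁ + n₂)) → Maybe (Fin (suc (n₁ + n₂)))
  parentᶠ attach zero    = nothing
  parentᶠ attach (suc v) =
    [ (λ a → parentˡ (parent F₁ a)) , (λ b → parentʳ attach (parent F₂ b)) ]′ (splitAt n₁ v)

  depthᶠ : Bool → Fin (suc (n₁ + n₂)) → ℕ
  depthᶠ attach zero    = 1
  depthᶠ attach (suc v) =
    [ (λ a → suc (depth F₁ a)) , (λ b → raiseIf attach (depth F₂ b)) ]′ (splitAt n₁ v)

  parent-embedˡ : ∀ attach a → parentᶠ attach (embedˡ a) ≡ parentˡ (parent F₁ a)
  parent-embedˡ attach a rewrite splitAt-↑ˡ n₁ a n₂ = refl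

  parent-embedʳ : ∀ attach b → parentᶠ attach (embedʳ b) ≡ parentʳ attach (parent F₂ b)
  parent-embedʳ attach b rewrite splitAt-↑ʳ n₁ n₂ b = refl

  depth-embedˡ : ∀ attach a → depthᶠ attach (embedˡ a) ≡ suc (depth F₁ a)
  depth-embedˡ attach a rewrite splitAt-↑ˡ n₁ a n₂ = refl

  depth-embedʳ : ∀ attach b → depthᶠ attach (embedʳ b) ≡ raiseIf attach (depth F₂ b)
  depth-embedʳ attach b rewrite splitAt-↑ʳ n₁ n₂ b = refl

  depth-rootʳ : ∀ attach b → parentʳ attach (parent F₂ b) ≡ nothing → raiseIf attach (depth F₂ b) ≡ 1
  depth-rootʳ attach b root with parent F₂ b in eq
  depth-rootʳ attach b ()   | just _
  depth-rootʳ true   b ()   | nothing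
  depth-rootʳ false  b _    | nothing = depth-root F₂ b eq

  depthᶠ-root : ∀ attach v → parentᶠ attach v ≡ nothing → depthᶠ attach v ≡ 1
  depthᶠ-root attach v root with position v
  ... | top   = refl
  ... | inˡ a = ⊥-elim (parentˡ≢nothing (parent F₁ a) (trans (sym (parent-embedˡ attach a)) root))
  ... | inʳ b = trans (depth-embedʳ attach b)
                      (depth-rootʳ attach b (trans (sym (parent-embedʳ attach b)) root))

  depth-stepˡ : ∀ attach a u → parentˡ (parent F₁ a) ≡ just u → depth F₁ a ≡ depthᶠ attach u
  depth-stepˡ attach a u step with parent F₁ a in eq | step
  ... | just a' | refl = trans (depth-step F₁ a a' eq) (sym (depth-embedˡ attach a'))
  ... | nothing | refl = depth-root F₁ a eq

  depth-stepʳ : ∀ attach b u → parentʳ attach (parent F₂ b) ≡ just u →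
                raiseIf attach (depth F₂ b) ≡ 1 + depthᶠ attach u
  depth-stepʳ attach b u step with parent F₂ b in eq | attach | step
  ... | just b' | true  | refl = cong (1 +_) (trans (depth-step F₂ b b' eq) (sym (depth-embedʳ true b')))
  ... | just b' | false | refl = trans (depth-step F₂ b b' eq) (cong (1 +_) (sym (depth-embedʳ false b')))
  ... | nothing | true  | refl = cong (1 +_) (depth-root F₂ b eq)
  ... | nothing | false | ()

  depthᶠ-step : ∀ attach v u → parentᶠ attach v ≡ just u → depthᶠ attach v ≡ suc (depthᶠ attach u)
  depthᶠ-step attach v u step with position v
  ... | top with step
  ...   | ()
  depthᶠ-step attach v u step | inˡ a =
    trans (depth-embedˡ attach a)
          (cong (1 +_) (depth-stepˡ attach a u (trans (sym (parent-embedˡ attach a)) step)))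
  depthᶠ-step attach v u step | inʳ b =
    trans (depth-embedʳ attach b) (depth-stepʳ attach b u (trans (sym (parent-embedʳ attach b)) step))

  forest : Bool → RootedForest (suc (n₁ + n₂))
  forest attach = record
    { parent     = parentᶠ attach
    ; depth      = depthᶠ attach
    ; depth-root = depthᶠ-root attach
    ; depth-step = depthᶠ-step attach
    }

  Ancestor-embedˡ : ∀ attach {u v} → Ancestor F₁ u v → Ancestor (forest attach) (embedˡ u) (embedˡ v)
  Ancestor-embedˡ attach here                    = here
  Ancestor-embedˡ attach (there {v = v} eq u≼w) =
    there (trans (parent-embedˡ attach v) (cong parentˡ eq)) (Ancestor-embedˡ attach u≼w)

  Ancestor-embedʳ : ∀ attach {u v} → Ancestor F₂ u v → Ancestor (forest attach) (embedʳ u) (embedʳ v)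
  Ancestor-embedʳ attach here                    = here
  Ancestor-embedʳ attach (there {v = v} eq u≼w) =
    there (trans (parent-embedʳ attach v) (cong (parentʳ attach) eq)) (Ancestor-embedʳ attach u≼w)

  top-ancestorˡ : ∀ attach a → Ancestor (forest attach) zero (embedˡ a)
  top-ancestorˡ attach a with root-ancestor F₁ a
  ... | r , root , r≼a = Ancestor-trans
    (there (trans (parent-embedˡ attach r) (cong parentˡ root)) here) (Ancestor-embedˡ attach r≼a)

  top-ancestorʳ : ∀ b → Ancestor (forest true) zero (embedʳ b)
  top-ancestorʳ b with root-ancestor F₂ b
  ... | r , root , r≼b = Ancestor-trans
    (there (trans (parent-embedʳ true r) (cong (parentʳ true) root)) here) (Ancestor-embedʳ true r≼b)

  forest-height : ∀ attach {h₁ h₂ h} → HeightAtMost F₁ h₁ → HeightAtMost F₂ h₂ →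
                  suc h₁ ≤ h → raiseIf attach h₂ ≤ h → HeightAtMost (forest attach) h
  forest-height attach {h = h} height₁ height₂ h₁<h h₂≤h v with position v
  ... | top   = ≤-trans (s≤s z≤n) h₁<h
  ... | inˡ a = subst (_≤ h) (sym (depth-embedˡ attach a)) (≤-trans (s≤s (height₁ a)) h₁<h)
  ... | inʳ b = subst (_≤ h) (sym (depth-embedʳ attach b))
                      (≤-trans (raiseIf-mono attach (height₂ b)) h₂≤h)

apexForest-closure : ∀ {G₁ G₂ N₁ N₂ F₁ F₂} attach → ClosureContains G₁ F₁ → ClosureContains G₂ F₂ →
                     attach ≡ true ⊎ N₂ ≡ ⊥ →
                     ClosureContains (apexJoin G₁ G₂ N₁ N₂) (ApexForest.forest F₁ F₂ attach)
apexForest-closure {G₁} {G₂} {N₁} {N₂} {F₁} {F₂} attach closure₁ closure₂ attached∨N₂≡⊥ = closure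
  where
  open ApexJoin G₁ G₂ N₁ N₂
  open ApexForest F₁ F₂
  G = apexJoin G₁ G₂ N₁ N₂
  top-edgeʳ : ∀ b → Edge G zero (embedʳ b) → Ancestor (forest attach) zero (embedʳ b)
  top-edgeʳ b e = [ (λ attached → subst (λ t → Ancestor (forest t) zero (embedʳ b)) (sym attached)
                                         (top-ancestorʳ b))
                  , (λ N₂≡⊥ → ⊥-elim (false≢true (begin
                      false                    ≡⟨ lookup-⊥ b ⟨
                      lookup ⊥ b               ≡⟨ cong (λ N → lookup N b) N₂≡⊥ ⟨
                      lookup N₂ b              ≡⟨ adj-topʳ b ⟨
                      adj G zero (embedʳ b)    ≡⟨ e ⟩
                      true                     ∎)))
                  ]′ attached∨N₂≡⊥
    where open ≡-Reasoning
  closure : ClosureContains G (forest attach)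
  closure u v e with position u | position v
  ... | top   | top    = ⊥-elim (false≢true e)
  ... | top   | inˡ a  = inj₁ (top-ancestorˡ attach a)
  ... | inˡ a | top    = inj₂ (top-ancestorˡ attach a)
  ... | top   | inʳ b  = inj₁ (top-edgeʳ b e)
  ... | inʳ b | top    = inj₂ (top-edgeʳ b (trans (Graph.sym G zero (embedʳ b)) e))
  ... | inˡ a | inˡ a' = Sum.map (Ancestor-embedˡ attach) (Ancestor-embedˡ attach)
                                 (closure₁ a a' (trans (sym (adj-ˡˡ a a')) e))
  ... | inʳ b | inʳ b' = Sum.map (Ancestor-embedʳ attach) (Ancestor-embedʳ attach)
                                 (closure₂ b b' (trans (sym (adj-ʳʳ b b')) e))
  ... | inˡ a | inʳ b  = ⊥-elim (false≢true (trans (sym (adj-ˡʳ a b)) e))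
  ... | inʳ b | inˡ a  = ⊥-elim (false≢true (trans (sym (adj-ʳˡ b a)) e))

emptyGraph : Graph
emptyGraph = record { n = 0 ; adj = λ () ; sym = λ () ; irrfl = λ () }

emptyForest : RootedForest 0
emptyForest = record { parent = λ () ; depth = λ () ; depth-root = λ () ; depth-step = λ () }

complete : ℕ → Graph
complete zero    = emptyGraph
complete (suc k) = apexJoin (complete k) emptyGraph ⊤ []

module CompleteJoin (k : ℕ) = ApexJoin (complete k) emptyGraph ⊤ []

complete-forest : ∀ k → RootedForest (n (complete k))
complete-forest zero    = emptyForest
complete-forest (suc k) = ApexForest.forest (complete-forest k) emptyForest true

complete-height : ∀ k → HeightAtMost (complete-forest k) k
complete-height zero    = λ ()
complete-height (suc k) =
  ApexForest.forest-height (complete-forest k) emptyForest true (complete-height k) (λ ()) ≤-refl (s≤s z≤n)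

complete-closure : ∀ k → ClosureContains (complete k) (complete-forest k)
complete-closure zero    = λ ()
complete-closure (suc k) = apexForest-closure true (complete-closure k) (λ ()) (inj₁ refl)

complete-stable-≤1 : ∀ k S → Stable (complete k) S → ∣ S ∣ ≤ 1
complete-stable-≤1 zero    [] _ = z≤n
complete-stable-≤1 (suc k) S st = bound (unglue S) st
  where
  open CompleteJoin k
  ∣S₁++[]∣ : ∀ S₁ → ∣ S₁ ++ [] ∣ ≡ ∣ S₁ ∣
  ∣S₁++[]∣ S₁ = trans (∣++∣ S₁ []) (+-identityʳ _)
  bound : ∀ {S} → Glued S → Stable (complete (suc k)) S → ∣ S ∣ ≤ 1
  bound (glued false S₁ []) st = begin
    ∣ S₁ ++ [] ∣   ≡⟨ ∣S₁++[]∣ S₁ ⟩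
    ∣ S₁ ∣         ≤⟨ complete-stable-≤1 k S₁ (proj₁ (Stable-glue⁻ false S₁ [] st)) ⟩
    1              ∎
    where open ≤-Reasoning
  bound (glued true S₁ []) st = s≤s (≤-reflexive (trans (∣S₁++[]∣ S₁)
    (Disjoint-⊤⇒∣∣≡0 S₁ (proj₁ (proj₂ (proj₂ (Stable-glue⁻ true S₁ [] st)) refl)))))

complete-vertex : ∀ k → Fin k → Fin (n (complete k))
complete-vertex (suc k) zero    = zero
complete-vertex (suc k) (suc i) = CompleteJoin.embedˡ k (complete-vertex k i)

complete-edge : ∀ k i j → i ≢ j → Edge (complete k) (complete-vertex k i) (complete-vertex k j)
complete-edge (suc k) zero    zero    i≢j = ⊥-elim (i≢j refl)
complete-edge (suc k) zero    (suc j) _   =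
  trans (CompleteJoin.adj-topˡ k (complete-vertex k j)) (lookup-replicate (complete-vertex k j) true)
complete-edge (suc k) (suc i) zero    _   =
  trans (Graph.sym (complete (suc k)) (complete-vertex (suc k) (suc i)) zero)
        (complete-edge (suc k) zero (suc i) λ ())
complete-edge (suc k) (suc i) (suc j) i≢j =
  trans (CompleteJoin.adj-ˡˡ k _ _) (complete-edge k i j (λ i≡j → i≢j (cong suc i≡j)))

≤+≤⇒≤2* : ∀ {s₁ s₂ b} → s₁ ≤ b → s₂ ≤ b → s₁ + s₂ ≤ 2 * b
≤+≤⇒≤2* {b = b} s₁≤b s₂≤b = +-mono-≤ s₁≤b (subst (_ ≤_) (sym (+-identityʳ b)) s₂≤b)

≤+<⇒<2* : ∀ {s₁ s₂ b} → s₁ ≤ b → s₂ < b → s₁ + s₂ < 2 * b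
≤+<⇒<2* {b = b} s₁≤b s₂<b = +-mono-≤-< s₁≤b (subst (_ <_) (sym (+-identityʳ b)) s₂<b)

<+<⇒suc<2* : ∀ {s₁ s₂ b} → s₁ < b → s₂ < b → suc (s₁ + s₂) < 2 * b
<+<⇒suc<2* {s₁} {s₂} s₁<b s₂<b =
  ≤-trans (≤-reflexive (cong (1 +_) (sym (+-suc s₁ s₂)))) (≤+≤⇒≤2* s₁<b s₂<b)

2*≤+ : ∀ {s₁ s₂ b} → b ≤ s₁ → b ≤ s₂ → 2 * b ≤ s₁ + s₂
2*≤+ {b = b} b≤s₁ b≤s₂ = +-mono-≤ b≤s₁ (subst (_≤ _) (sym (+-identityʳ b)) b≤s₂)

2*≤suc+ : ∀ {s₁ s₂ b} → b ≤ s₁ → b ≤ suc s₂ → 2 * b ≤ suc (s₁ + s₂)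
2*≤suc+ {s₁} {s₂} b≤s₁ b≤s₂ = ≤-trans (2*≤+ b≤s₁ b≤s₂) (≤-reflexive (+-suc s₁ s₂))

≤+≤1⇒≤1+ : ∀ {s₁ s₂ b} → s₁ ≤ b → s₂ ≤ 1 → s₁ + s₂ ≤ 1 + b
≤+≤1⇒≤1+ {b = b} s₁≤b s₂≤1 = ≤-trans (+-mono-≤ s₁≤b s₂≤1) (≤-reflexive (+-comm b 1))

-- The gadget

Gadget : ℕ → Graph
N : ∀ m → Subset (n (Gadget m))
M : ∀ m → Subset (n (Gadget m))

Gadget zero    = complete 2
Gadget (suc m) = apexJoin (Gadget m) (Gadget m) (N m) (M m)

N zero    = ⁅ suc zero ⁆
N (suc m) = glue false ⊥ (N m)

M zero    = ⊤
M (suc m) = glue true ⊥ (M m)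

Y : ∀ m → Subset (n (Gadget m))
Y zero    = ⁅ zero ⁆
Y (suc m) = glue false (Y m) (Y m)

module GadgetJoin (m : ℕ) = ApexJoin (Gadget m) (Gadget m) (N m) (M m)

N⊆M : ∀ m i → lookup (N m) i ≡ true → lookup (M m) i ≡ true
N⊆M zero    (suc zero) _   = refl
N⊆M (suc m) i i∈N = go (position i) i∈N
  where
  open GadgetJoin m
  open GlueMembership false ⊥ (N m)
  go : ∀ {i} → Position i → lookup (N (suc m)) i ≡ true → lookup (M (suc m)) i ≡ true
  go top     ()
  go (inˡ a) a∈N = ⊥-elim (false≢true (trans (sym (lookup-⊥ a)) (∈ˡ⁻ a a∈N)))
  go (inʳ b) b∈N = trans (lookup-glueʳ true ⊥ (M m) b) (N⊆M m b (∈ʳ⁻ b b∈N))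

gadget-stable-≤ : ∀ m S → Stable (Gadget m) S → ∣ S ∣ ≤ 2 ^ m
gadget-stable-#M-< : ∀ m S → Stable (Gadget m) S → Disjoint S (M m) → ∣ S ∣ < 2 ^ m
gadget-stable-#N#Y-< : ∀ m S → Stable (Gadget m) S → Disjoint S (N m) → Disjoint S (Y m) → ∣ S ∣ < 2 ^ m

gadget-stable-≤ zero    S st = complete-stable-≤1 2 S st
gadget-stable-≤ (suc m) S st = bound (unglue S) st
  where
  open GadgetJoin m
  bound : ∀ {S} → Glued S → Stable (Gadget (suc m)) S → ∣ S ∣ ≤ 2 ^ suc m
  bound (glued false S₁ S₂) st with Stable-glue⁻ false S₁ S₂ st
  ... | st₁ , st₂ , _ rewrite ∣++∣ S₁ S₂ =
    ≤+≤⇒≤2* (gadget-stable-≤ m S₁ st₁) (gadget-stable-≤ m S₂ st₂)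
  bound (glued true S₁ S₂) st with Stable-glue⁻ true S₁ S₂ st
  ... | st₁ , st₂ , st₀ rewrite ∣++∣ S₁ S₂ =
    ≤+<⇒<2* (gadget-stable-≤ m S₁ st₁) (gadget-stable-#M-< m S₂ st₂ (proj₂ (st₀ refl)))

gadget-stable-#M-< zero    S _  S#M = ≤-reflexive (cong suc (Disjoint-⊤⇒∣∣≡0 S S#M))
gadget-stable-#M-< (suc m) S st S#M = bound (unglue S) st S#M
  where
  open GadgetJoin m
  bound : ∀ {S} → Glued S → Stable (Gadget (suc m)) S → Disjoint S (M (suc m)) → ∣ S ∣ < 2 ^ suc m
  bound (glued x S₁ S₂) st S#M with Stable-glue⁻ x S₁ S₂ st | Disjoint-glue⁻ x S₁ S₂ true ⊥ (M m) S#M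
  bound (glued false S₁ S₂) st S#M | st₁ , st₂ , _ | _ , _ , S₂#M rewrite ∣++∣ S₁ S₂ =
    ≤+<⇒<2* (gadget-stable-≤ m S₁ st₁) (gadget-stable-#M-< m S₂ st₂ S₂#M)
  bound (glued true S₁ S₂) st S#M | _ | apex∉M , _ with apex∉M refl
  ... | ()

gadget-stable-#N#Y-< zero (false ∷ false ∷ []) _ _   _   = s≤s z≤n
gadget-stable-#N#Y-< zero (true  ∷ _     ∷ []) _ _   S#Y with S#Y zero refl
... | ()
gadget-stable-#N#Y-< zero (false ∷ true  ∷ []) _ S#N _   with S#N (suc zero) refl
... | ()
gadget-stable-#N#Y-< (suc m) S st S#N S#Y = bound (unglue S) st S#N S#Y
  where
  open GadgetJoin m
  bound : ∀ {S} → Glued S → Stable (Gadget (suc m)) S → Disjoint S (N (suc m)) → Disjoint S (Y (suc m)) →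
          ∣ S ∣ < 2 ^ suc m
  bound (glued x S₁ S₂) st S#N S#Y
    with Stable-glue⁻ x S₁ S₂ st | Disjoint-glue⁻ x S₁ S₂ false ⊥ (N m) S#N
       | Disjoint-glue⁻ x S₁ S₂ false (Y m) (Y m) S#Y
  bound (glued false S₁ S₂) st S#N S#Y | st₁ , st₂ , _ | _ , _ , S₂#N | _ , _ , S₂#Y rewrite ∣++∣ S₁ S₂ =
    ≤+<⇒<2* (gadget-stable-≤ m S₁ st₁) (gadget-stable-#N#Y-< m S₂ st₂ S₂#N S₂#Y)
  bound (glued true S₁ S₂) st S#N S#Y | st₁ , st₂ , st₀ | _ | _ , S₁#Y , _ rewrite ∣++∣ S₁ S₂ =
    <+<⇒suc<2* (gadget-stable-#N#Y-< m S₁ st₁ (proj₁ (st₀ refl)) S₁#Y)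
               (gadget-stable-#M-< m S₂ st₂ (proj₂ (st₀ refl)))

Y-nonempty : ∀ m → Σ (Fin (n (Gadget m))) λ a → lookup (Y m) a ≡ true
Y-nonempty zero    = zero , refl
Y-nonempty (suc m) with Y-nonempty m
... | a , a∈Y = GadgetJoin.embedˡ m a , trans (GadgetJoin.lookup-glueˡ m false (Y m) (Y m) a) a∈Y

∣Y∣ : ∀ m → ∣ Y m ∣ ≡ 2 ^ m
∣Y∣ zero    = refl
∣Y∣ (suc m) = trans (∣++∣ (Y m) (Y m)) (cong₂ _+_ (∣Y∣ m) (trans (∣Y∣ m) (sym (+-identityʳ _))))

stable-#Y : ∀ m → Σ (Subset (n (Gadget m))) λ S →
            Stable (Gadget m) S × Disjoint S (Y m) × 2 ^ m ≤ ∣ S ∣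
stable-#Y zero = ⁅ suc zero ⁆ , singleton-stable (Gadget zero) (suc zero) , S#Y , s≤s z≤n
  where
  S#Y : Disjoint ⁅ suc zero ⁆ (Y zero)
  S#Y zero       ()
  S#Y (suc zero) _ = refl
stable-#Y (suc m) with stable-#Y m
... | S , st , S#Y , 2^m≤∣S∣ =
    glue false S S
  , Stable-glue⁺ false S S st st (λ ())
  , Disjoint-glue⁺ false S S false (Y m) (Y m) (λ ()) S#Y S#Y
  , subst (_ ≤_) (sym (∣++∣ S S)) (2*≤+ 2^m≤∣S∣ 2^m≤∣S∣)
  where open GadgetJoin m

stable-#M#Y : ∀ m → Σ (Subset (n (Gadget m))) λ S →
              Stable (Gadget m) S × Disjoint S (M m) × Disjoint S (Y m) × 2 ^ m ≤ suc ∣ S ∣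
stable-#M#Y zero = ⊥ , ⊥-stable (Gadget zero) , ⊥-Disjoint (M zero) , ⊥-Disjoint (Y zero) , s≤s z≤n
stable-#M#Y (suc m) with stable-#Y m | stable-#M#Y m
... | S₁ , st₁ , S₁#Y , 2^m≤∣S₁∣ | S₂ , st₂ , S₂#M , S₂#Y , 2^m≤1+∣S₂∣ =
    glue false S₁ S₂
  , Stable-glue⁺ false S₁ S₂ st₁ st₂ (λ ())
  , Disjoint-glue⁺ false S₁ S₂ true ⊥ (M m) (λ ()) (Disjoint-⊥ S₁) S₂#M
  , Disjoint-glue⁺ false S₁ S₂ false (Y m) (Y m) (λ ()) S₁#Y S₂#Y
  , subst (λ s → _ ≤ suc s) (sym (∣++∣ S₁ S₂)) (2*≤suc+ 2^m≤∣S₁∣ 2^m≤1+∣S₂∣)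
  where open GadgetJoin m

stable-through : ∀ m a → lookup (Y m) a ≡ true → Σ (Subset (n (Gadget m))) λ S →
                 Stable (Gadget m) S × Disjoint S (N m) × MeetsOnlyAt S (Y m) a × 2 ^ m ≤ ∣ S ∣
stable-through zero zero       _ = ⁅ zero ⁆ , singleton-stable (Gadget zero) zero , S#N , meets , s≤s z≤n
  where
  S#N : Disjoint ⁅ zero ⁆ (N zero)
  S#N zero       _  = refl
  S#N (suc zero) ()
  meets : MeetsOnlyAt ⁅ zero ⁆ (Y zero) zero
  meets zero       _  _ = refl
  meets (suc zero) () _
stable-through zero (suc zero) ()
stable-through (suc m) a a∈Y = through (position a) a∈Y
  where
  open GadgetJoin m
  through : ∀ {a} → Position a → lookup (Y (suc m)) a ≡ true → Σ (Subset (n (Gadget (suc m)))) λ S →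
            Stable (Gadget (suc m)) S × Disjoint S (N (suc m)) × MeetsOnlyAt S (Y (suc m)) a × 2 ^ suc m ≤ ∣ S ∣
  through top ()
  through (inˡ a) a∈Y with stable-through m a (GlueMembership.∈ˡ⁻ false (Y m) (Y m) a a∈Y) | stable-#M#Y m
  ... | S₁ , st₁ , S₁#N , meets₁ , 2^m≤∣S₁∣ | S₂ , st₂ , S₂#M , S₂#Y , 2^m≤1+∣S₂∣ =
      glue true S₁ S₂
    , Stable-glue⁺ true S₁ S₂ st₁ st₂ (λ _ → S₁#N , S₂#M)
    , Disjoint-glue⁺ true S₁ S₂ false ⊥ (N m) (λ _ → refl) (Disjoint-⊥ S₁)
        (Disjoint-antitone {S = S₂} {T = N m} {U = M m} (N⊆M m) S₂#M)
    , meets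
    , subst (λ s → _ ≤ suc s) (sym (∣++∣ S₁ S₂)) (2*≤suc+ 2^m≤∣S₁∣ 2^m≤1+∣S₂∣)
    where
    open GlueMembership
    meets : MeetsOnlyAt (glue true S₁ S₂) (Y (suc m)) (embedˡ a)
    meets j j∈S j∈Y with position j
    ... | top    = ⊥-elim (false≢true j∈Y)
    ... | inˡ a' = cong embedˡ (meets₁ a' (∈ˡ⁻ true S₁ S₂ a' j∈S) (∈ˡ⁻ false (Y m) (Y m) a' j∈Y))
    ... | inʳ b' = ⊥-elim (false≢true
                     (trans (sym (S₂#Y b' (∈ʳ⁻ true S₁ S₂ b' j∈S))) (∈ʳ⁻ false (Y m) (Y m) b' j∈Y)))
  through (inʳ b) b∈Y with stable-#Y m | stable-through m b (GlueMembership.∈ʳ⁻ false (Y m) (Y m) b b∈Y)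
  ... | S₁ , st₁ , S₁#Y , 2^m≤∣S₁∣ | S₂ , st₂ , S₂#N , meets₂ , 2^m≤∣S₂∣ =
      glue false S₁ S₂
    , Stable-glue⁺ false S₁ S₂ st₁ st₂ (λ ())
    , Disjoint-glue⁺ false S₁ S₂ false ⊥ (N m) (λ ()) (Disjoint-⊥ S₁) S₂#N
    , meets
    , subst (_ ≤_) (sym (∣++∣ S₁ S₂)) (2*≤+ 2^m≤∣S₁∣ 2^m≤∣S₂∣)
    where
    open GlueMembership
    meets : MeetsOnlyAt (glue false S₁ S₂) (Y (suc m)) (embedʳ b)
    meets j j∈S j∈Y with position j
    ... | top    = ⊥-elim (false≢true j∈Y)
    ... | inˡ a' = ⊥-elim (false≢true
                     (trans (sym (S₁#Y a' (∈ˡ⁻ false S₁ S₂ a' j∈S))) (∈ˡ⁻ false (Y m) (Y m) a' j∈Y)))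
    ... | inʳ b' = cong embedʳ (meets₂ b' (∈ʳ⁻ false S₁ S₂ b' j∈S) (∈ʳ⁻ false (Y m) (Y m) b' j∈Y))

-- The construction

gadget-forest : ∀ m → RootedForest (n (Gadget m))
gadget-forest zero    = complete-forest 2
gadget-forest (suc m) = ApexForest.forest (gadget-forest m) (gadget-forest m) true

gadget-height : ∀ m → HeightAtMost (gadget-forest m) (2 + m)
gadget-height zero    = complete-height 2
gadget-height (suc m) = ApexForest.forest-height (gadget-forest m) (gadget-forest m) true
  (gadget-height m) (gadget-height m) ≤-refl ≤-refl

gadget-closure : ∀ m → ClosureContains (Gadget m) (gadget-forest m)
gadget-closure zero    = complete-closure 2
gadget-closure (suc m) = apexForest-closure true (gadget-closure m) (gadget-closure m) (inj₁ refl)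

module Construction (m : ℕ) where

  c : ℕ
  c = 3 + m

  G : Graph
  G = apexJoin (Gadget m) (complete c) (N m) ⊥

  open ApexJoin (Gadget m) (complete c) (N m) ⊥

  ∅ᶜ : Subset (n (complete c))
  ∅ᶜ = ⊥

  ⁅apex⁆ᶜ : Subset (n (complete c))
  ⁅apex⁆ᶜ = ⁅ zero ⁆

  ∣⁅apex⁆ᶜ∣ : ∣ ⁅apex⁆ᶜ ∣ ≡ 1
  ∣⁅apex⁆ᶜ∣ = ∣⁅x⁆∣≡1 {n = n (complete (2 + m)) + n emptyGraph} zero

  Y₀ : Subset (n G)
  Y₀ = glue false (Y m) ∅ᶜ

  td≤c : TdAtMost G c
  td≤c = ApexForest.forest (gadget-forest m) (complete-forest c) false
       , ApexForest.forest-height (gadget-forest m) (complete-forest c) false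
           (gadget-height m) (complete-height c) ≤-refl ≤-refl
       , apexForest-closure false (gadget-closure m) (complete-closure c) (inj₂ refl)

  td≥c : ∀ h → TdAtMost G h → c ≤ h
  td≥c h = clique⇒td≥ G (λ i → embedʳ (complete-vertex c i))
    (λ i j i≢j → trans (adj-ʳʳ _ _) (complete-edge c i j i≢j))

  2^m≤∣Y₀∣ : 2 ^ m ≤ ∣ Y₀ ∣
  2^m≤∣Y₀∣ = ≤-reflexive (sym (begin
    ∣ Y m ++ ∅ᶜ ∣       ≡⟨ ∣++∣ (Y m) ∅ᶜ ⟩
    ∣ Y m ∣ + ∣ ∅ᶜ ∣    ≡⟨ cong₂ _+_ (∣Y∣ m) (∣⊥∣≡0 (n (complete c))) ⟩
    2 ^ m + 0           ≡⟨ +-identityʳ _ ⟩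
    2 ^ m               ∎))
    where open ≡-Reasoning

  stable-≤ : ∀ S → Stable G S → ∣ S ∣ ≤ 2 + 2 ^ m
  stable-≤ S st = bound (unglue S) st
    where
    bound : ∀ {S} → Glued S → Stable G S → ∣ S ∣ ≤ 2 + 2 ^ m
    bound (glued x S₁ S₂) st with Stable-glue⁻ x S₁ S₂ st
    bound (glued false S₁ S₂) st | st₁ , st₂ , _ rewrite ∣++∣ S₁ S₂ =
      ≤-trans (≤+≤1⇒≤1+ (gadget-stable-≤ m S₁ st₁) (complete-stable-≤1 c S₂ st₂)) (n≤1+n _)
    bound (glued true S₁ S₂) st | st₁ , st₂ , _ rewrite ∣++∣ S₁ S₂ =
      s≤s (≤+≤1⇒≤1+ (gadget-stable-≤ m S₁ st₁) (complete-stable-≤1 c S₂ st₂))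

  stable-#Y₀-≤ : ∀ S → Stable G S → Disjoint S Y₀ → ∣ S ∣ ≤ 1 + 2 ^ m
  stable-#Y₀-≤ S st S#Y₀ = bound (unglue S) st S#Y₀
    where
    bound : ∀ {S} → Glued S → Stable G S → Disjoint S Y₀ → ∣ S ∣ ≤ 1 + 2 ^ m
    bound (glued x S₁ S₂) st S#Y₀ with Stable-glue⁻ x S₁ S₂ st | Disjoint-glue⁻ x S₁ S₂ false (Y m) ∅ᶜ S#Y₀
    bound (glued false S₁ S₂) st S#Y₀ | st₁ , st₂ , _ | _ rewrite ∣++∣ S₁ S₂ =
      ≤+≤1⇒≤1+ (gadget-stable-≤ m S₁ st₁) (complete-stable-≤1 c S₂ st₂)
    bound (glued true S₁ S₂) st S#Y₀ | st₁ , st₂ , st₀ | _ , S₁#Y , _ rewrite ∣++∣ S₁ S₂ =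
      ≤+≤1⇒≤1+ (gadget-stable-#N#Y-< m S₁ st₁ (proj₁ (st₀ refl)) S₁#Y) (complete-stable-≤1 c S₂ st₂)

  stable-through-Y₀ : ∀ a → lookup (Y m) a ≡ true → Σ (Subset (n G)) λ S →
                      Stable G S × MeetsOnlyAt S Y₀ (embedˡ a) × 2 + 2 ^ m ≤ ∣ S ∣
  stable-through-Y₀ a a∈Y with stable-through m a a∈Y
  ... | S₁ , st₁ , S₁#N , meets₁ , 2^m≤∣S₁∣ =
      glue true S₁ ⁅apex⁆ᶜ
    , Stable-glue⁺ true S₁ ⁅apex⁆ᶜ st₁ (singleton-stable (complete c) zero)
                   (λ _ → S₁#N , Disjoint-⊥ ⁅apex⁆ᶜ)
    , meets
    , s≤s (begin
        1 + 2 ^ m                   ≤⟨ s≤s 2^m≤∣S₁∣ ⟩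
        1 + ∣ S₁ ∣                  ≡⟨ +-comm 1 ∣ S₁ ∣ ⟩
        ∣ S₁ ∣ + 1                  ≡⟨ cong (∣ S₁ ∣ +_) ∣⁅apex⁆ᶜ∣ ⟨
        ∣ S₁ ∣ + ∣ ⁅apex⁆ᶜ ∣       ≡⟨ ∣++∣ S₁ ⁅apex⁆ᶜ ⟨
        ∣ S₁ ++ ⁅apex⁆ᶜ ∣          ∎)
    where
    open ≤-Reasoning
    open GlueMembership
    meets : MeetsOnlyAt (glue true S₁ ⁅apex⁆ᶜ) Y₀ (embedˡ a)
    meets j j∈S j∈Y₀ with position j
    ... | top    = ⊥-elim (false≢true j∈Y₀)
    ... | inˡ a' = cong embedˡ (meets₁ a' (∈ˡ⁻ true S₁ ⁅apex⁆ᶜ a' j∈S) (∈ˡ⁻ false (Y m) ∅ᶜ a' j∈Y₀))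
    ... | inʳ b' = ⊥-elim (false≢true (trans (sym (lookup-⊥ b')) (∈ʳ⁻ false (Y m) ∅ᶜ b' j∈Y₀)))

  conf-Y₀-positive : 0 < conf G Y₀
  conf-Y₀-positive with Y-nonempty m
  ... | a , a∈Y with stable-through-Y₀ a a∈Y
  ...   | S , st , _ , 2+2^m≤∣S∣ = conf-positive G Y₀ S (1 + 2 ^ m) st 2+2^m≤∣S∣ stable-#Y₀-≤

  conf-⊂Y₀-zero : ∀ Y' → Y' ⊂ Y₀ → conf G Y' ≡ 0
  conf-⊂Y₀-zero Y' (Y'⊆Y₀ , i , i∈Y₀ , i∉Y') = missed (position i) ([]=⇒lookup i∈Y₀) i∉Y'
    where
    open GlueMembership false (Y m) ∅ᶜ
    missed : ∀ {i} → Position i → lookup Y₀ i ≡ true → i ∉ Y' → conf G Y' ≡ 0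
    missed top     ()
    missed (inʳ b) b∈Y₀ _ = ⊥-elim (false≢true (trans (sym (lookup-⊥ b)) (∈ʳ⁻ b b∈Y₀)))
    missed (inˡ a) a∈Y₀ a∉Y' with stable-through-Y₀ a (∈ˡ⁻ a a∈Y₀)
    ... | S , st , meets , 2+2^m≤∣S∣ =
      conf-zero G Y' S (2 + 2 ^ m) stable-≤ st (MeetsOnlyAt⇒Disjoint S Y₀ Y' meets Y'⊆Y₀ a∉Y')
                2+2^m≤∣S∣

lemma2 : Σ ℕ λ λ₀ → (c : ℕ) → λ₀ ≤ c →
           Σ Graph λ G → Σ (Subset (n G)) λ Y →
             TdEq G c × (2 ^ (c ∸ 3) ≤ ∣ Y ∣) × (0 < conf G Y) ×
             ((Y' : Subset (n G)) → Y' ⊂ Y → conf G Y' ≡ 0)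
lemma2 .proj₁ = 3
lemma2 .proj₂ 0             ()
lemma2 .proj₂ 1             (s≤s ())
lemma2 .proj₂ 2             (s≤s (s≤s ()))
lemma2 .proj₂ (suc (suc (suc m))) _ =
  G , Y₀ , (td≤c , td≥c) , 2^m≤∣Y₀∣ , conf-Y₀-positive , conf-⊂Y₀-zero
  where open Construction m
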